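{- Every subsequence of a fully interlacing sequence $(A_0(x)\, \cdots\, A_{p-1}(x))^\top$ of formal power series in $\mathbb{R}[[x]]$ is fully interlacing. In particular, every fully interlacing sequence is pairwise interlacing, i.e. $A_i(x) \prec A_j(x)$ for all $0\le i<j\le p-1$.
   Context: A $\mathbb{Z}\times\mathbb{Z}$ real matrix is totally positive (TP) if every finite square submatrix has nonnegative determinant. For a $p\times q$ matrix $\mathcal{A} = (A_{ij}(x))_{0\le i<p,\,0\le j<q}$ of formal power series $A_{ij}(x) = \sum_{n\ge 0} a_{ij}(n)x^n \in \mathbb{R}[[x]]$ (with $a_{ij}(n) = 0$ for $n<0$), the matrix $\mathrm{Lace}(\mathcal{A}) = (M_{uv})_{u,v\in\mathbb{Z}}$ is defined as follows: for $(u,v)\in\mathbb{Z}\times\mathbb{Z}$ write uniquely $u = pu'+i$, $v = qv'+j$ with $u',v'\in\mathbb{Z}$, $0\le i<p$, $0\le j<q$, and set $M_{uv} = a_{ij}(v'-u')$. The matrix $\mathcal{A}$ is fully interlacing if $\mathrm{Lace}(\mathcal{A})$ is TP. A sequence of power series is regarded as a column matrix ($p\times 1$). For $A(x),B(x)\in\mathbb{R}[[x]]$, one writes $A(x)\prec B(x)$ ("$A$ interlaces $B$") if the column $(A(x)\ B(x))^\top$ is fully interlacing. -}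

module Defs where

open import Level using (Level; _⊔_)
open import Algebra.Bundles using (CommutativeRing)
open import Data.Nat as ℕ using (ℕ; zero; suc; NonZero)
open import Data.Nat.Properties as ℕP using ()
open import Data.Fin as Fin using (Fin; zero; suc; toℕ; fromℕ<; punchIn)
open import Data.Integer as ℤ using (ℤ; +_; -[1+_])
open import Data.Integer.DivMod using (_/ℕ_; _%ℕ_; n%ℕd<d)
open import Relation.Binary.Core using (Rel)

PowerSeries : ∀ {a} → Set a → Set a
PowerSeries R = ℕ → R

module OverRing {c ℓ ℓ'} (R : CommutativeRing c ℓ) (_≤_ : Rel (CommutativeRing.Carrier R) ℓ') where
  open CommutativeRing R using (Carrier; _+_; _*_; -_; 0#; 1#)

  coeffℤ : PowerSeries Carrier → ℤ → Carrier
  coeffℤ f (+ n)    = f n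
  coeffℤ f -[1+ n ] = 0#

  ∑ : ∀ n → (Fin n → Carrier) → Carrier
  ∑ zero    f = 0#
  ∑ (suc n) f = f zero + ∑ n (λ i → f (suc i))

  sign : ℕ → Carrier
  sign zero          = 1#
  sign (suc zero)    = - 1#
  sign (suc (suc j)) = sign j

  det : ∀ n → (Fin n → Fin n → Carrier) → Carrier
  det zero    M = 1#
  det (suc n) M =
    ∑ (suc n) (λ j → sign (toℕ j) * (M zero j * det n (λ a b → M (suc a) (punchIn j b))))

  StrictlyIncreasing : ∀ {n} → (Fin n → ℤ) → Set
  StrictlyIncreasing {n} r = ∀ (a b : Fin n) → a Fin.< b → r a ℤ.< r b

  TotallyPositive : (ℤ → ℤ → Carrier) → Set ℓ'
  TotallyPositive M =
    ∀ (n : ℕ) (r s : Fin n → ℤ) → StrictlyIncreasing r → StrictlyIncreasing s →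
    0# ≤ det n (λ a b → M (r a) (s b))

  -- u = p u' + i with 0 ≤ i < p
  quotℤ : (p : ℕ) → .{{NonZero p}} → ℤ → ℤ
  quotℤ p u = u /ℕ p

  remℤ : (p : ℕ) → .{{NonZero p}} → ℤ → Fin p
  remℤ p u = fromℕ< (n%ℕd<d u p)

  Lace : (p q : ℕ) → .{{NonZero p}} → .{{NonZero q}} →
         (Fin p → Fin q → PowerSeries Carrier) → ℤ → ℤ → Carrier
  Lace p q A u v = coeffℤ (A (remℤ p u) (remℤ q v)) (quotℤ q v ℤ.- quotℤ p u)

  FullyInterlacing : (p q : ℕ) → .{{NonZero p}} → .{{NonZero q}} →
                     (Fin p → Fin q → PowerSeries Carrier) → Set ℓ'
  FullyInterlacing p q A = TotallyPositive (Lace p q A)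

  asColumn : ∀ {p} → (Fin p → PowerSeries Carrier) → Fin p → Fin 1 → PowerSeries Carrier
  asColumn A i _ = A i

  FullyInterlacingSeq : (p : ℕ) → .{{NonZero p}} → (Fin p → PowerSeries Carrier) → Set ℓ'
  FullyInterlacingSeq p A = FullyInterlacing p 1 (asColumn A)

  pair : PowerSeries Carrier → PowerSeries Carrier → Fin 2 → PowerSeries Carrier
  pair A B zero    = A
  pair A B (suc _) = B

  _≺_ : PowerSeries Carrier → PowerSeries Carrier → Set ℓ'
  A ≺ B = FullyInterlacingSeq 2 (pair A B)

  StrictlyIncreasingFin : ∀ {k p} → (Fin k → Fin p) → Set
  StrictlyIncreasingFin {k} σ = ∀ (a b : Fin k) → a Fin.< b → σ a Fin.< σ b

{-# OPTIONS --safe #-}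
module Submission where

-- Row k u′ + a of Lace(A ∘ σ) is row p u′ + σ a of Lace(A).  As σ is strictly
-- increasing, so is u ↦ p u′ + σ a on ℤ (compare quotients and remainders
-- lexicographically), hence every square submatrix of Lace(A ∘ σ) is one of
-- Lace(A).  The pair A i, A j with i < j is the subsequence indexed by i ∷ j ∷ [].

open import Defs
open import Algebra.Bundles using (CommutativeRing)
open import Relation.Binary.Core using (Rel; _Preserves_⟶_)
open import Data.Nat using (ℕ; NonZero)
open import Data.Fin as Fin using (Fin; zero; suc; toℕ; punchIn)
open import Data.Product using (_×_; _,_; proj₁; proj₂)
open import Data.Empty using (⊥-elim)
open import Data.Product.Relation.Binary.Lex.Strict using (×-Lex; ×-compare)
open import Data.Product.Relation.Binary.Pointwise.NonDependent using (Pointwise)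
open import Data.Sum using (inj₁; inj₂)
import Data.Nat as ℕ
import Data.Nat.Properties as ℕP
import Data.Fin.Properties as FinP
open import Data.Vec.Functional using (_∷_; [])
open import Data.Integer as ℤ using (ℤ; +_)
import Data.Integer.Properties as ℤP
open import Data.Integer.DivMod using (_/ℕ_; _%ℕ_; n%ℕd<d; a≡a%ℕn+[a/ℕn]*n)
open import Relation.Binary.Definitions using (Trichotomous; tri<; tri≈; tri>)
open import Relation.Binary.PropositionalEquality

_<ₗₑₓ_ : Rel (ℤ × ℕ) _
_<ₗₑₓ_ = ×-Lex _≡_ ℤ._<_ ℕ._<_

<ₗₑₓ-cmp : Trichotomous (Pointwise _≡_ _≡_) _<ₗₑₓ_
<ₗₑₓ-cmp = ×-compare sym ℤP.<-cmp ℕP.<-cmp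

fromQuotRem : ℕ → ℤ × ℕ → ℤ
fromQuotRem d (q , i) = + i ℤ.+ q ℤ.* + d

quotRem : (d : ℕ) → .{{NonZero d}} → ℤ → ℤ × ℕ
quotRem d u = u /ℕ d , u %ℕ d

fromQuotRem-quotRem : ∀ d .{{_ : NonZero d}} u → u ≡ fromQuotRem d (quotRem d u)
fromQuotRem-quotRem d u = a≡a%ℕn+[a/ℕn]*n u d

fromQuotRem-mono-< : ∀ d {x y} → proj₂ x ℕ.< d → x <ₗₑₓ y → fromQuotRem d x ℤ.< fromQuotRem d y
fromQuotRem-mono-< d {q , i} {q′ , i′} i<d (inj₁ q<q′) = begin-strict
  + i ℤ.+ q ℤ.* + d     <⟨ ℤP.+-monoˡ-< (q ℤ.* + d) (ℤ.+<+ i<d) ⟩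
  + d ℤ.+ q ℤ.* + d     ≡⟨ ℤP.suc-* q (+ d) ⟨
  ℤ.suc q ℤ.* + d       ≤⟨ ℤP.*-monoʳ-≤-nonNeg (+ d) (ℤP.i<j⇒suc[i]≤j q<q′) ⟩
  q′ ℤ.* + d            ≤⟨ ℤP.i≤j+i _ (+ i′) ⟩
  + i′ ℤ.+ q′ ℤ.* + d   ∎
  where open ℤP.≤-Reasoning
fromQuotRem-mono-< d {q , i} _ (inj₂ (refl , i<i′)) = ℤP.+-monoˡ-< (q ℤ.* + d) (ℤ.+<+ i<i′)

fromQuotRem-cancel-< : ∀ d {x y} → proj₂ y ℕ.< d →
                       fromQuotRem d x ℤ.< fromQuotRem d y → x <ₗₑₓ y
fromQuotRem-cancel-< d {x} {y} y₂<d x<y with <ₗₑₓ-cmp x y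
... | tri< x<ₗₑₓy _ _        = x<ₗₑₓy
... | tri≈ _ (refl , refl) _ = ⊥-elim (ℤP.<-irrefl refl x<y)
... | tri> _ _ y<ₗₑₓx        = ⊥-elim (ℤP.<-asym x<y (fromQuotRem-mono-< d y₂<d y<ₗₑₓx))

fromQuotRem-injective : ∀ d {x y} → proj₂ x ℕ.< d → proj₂ y ℕ.< d →
                        fromQuotRem d x ≡ fromQuotRem d y → x ≡ y
fromQuotRem-injective d {x} {y} x₂<d y₂<d x≡y with <ₗₑₓ-cmp x y
... | tri< x<ₗₑₓy _ _        = ⊥-elim (ℤP.<-irrefl x≡y (fromQuotRem-mono-< d x₂<d x<ₗₑₓy))
... | tri≈ _ (refl , refl) _ = refl
... | tri> _ _ y<ₗₑₓx        = ⊥-elim (ℤP.<-irrefl (sym x≡y) (fromQuotRem-mono-< d y₂<d y<ₗₑₓx))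

quotRem-fromQuotRem : ∀ d .{{_ : NonZero d}} x → proj₂ x ℕ.< d → quotRem d (fromQuotRem d x) ≡ x
quotRem-fromQuotRem d x x₂<d =
  fromQuotRem-injective d (n%ℕd<d (fromQuotRem d x) d) x₂<d
    (sym (fromQuotRem-quotRem d (fromQuotRem d x)))

module _ {c ℓ ℓ′} (R : CommutativeRing c ℓ) (_≤_ : Rel (CommutativeRing.Carrier R) ℓ′) where
  open OverRing R _≤_
  open CommutativeRing R using (Carrier; 0#; _+_; _*_)

  ∑-cong : ∀ n {f g : Fin n → Carrier} → (∀ i → f i ≡ g i) → ∑ n f ≡ ∑ n g
  ∑-cong ℕ.zero    f≗g = refl
  ∑-cong (ℕ.suc n) f≗g = cong₂ _+_ (f≗g zero) (∑-cong n (λ i → f≗g (suc i)))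

  det-cong : ∀ n {M N : Fin n → Fin n → Carrier} → (∀ a b → M a b ≡ N a b) → det n M ≡ det n N
  det-cong ℕ.zero    M≗N = refl
  det-cong (ℕ.suc n) M≗N = ∑-cong (ℕ.suc n) λ j →
    cong₂ (λ x y → sign (toℕ j) * (x * y))
      (M≗N zero j) (det-cong n (λ a b → M≗N (suc a) (punchIn j b)))

  TotallyPositive-cong : ∀ {M N : ℤ → ℤ → Carrier} → (∀ u v → M u v ≡ N u v) →
                         TotallyPositive M → TotallyPositive N
  TotallyPositive-cong M≗N tpM n r s r↑ s↑ =
    subst (0# ≤_) (det-cong n (λ a b → M≗N (r a) (s b))) (tpM n r s r↑ s↑)

  TotallyPositive-rows : ∀ {M : ℤ → ℤ → Carrier} {f : ℤ → ℤ} → f Preserves ℤ._<_ ⟶ ℤ._<_ →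
                         TotallyPositive M → TotallyPositive (λ u v → M (f u) v)
  TotallyPositive-rows {f = f} f↑ tpM n r s r↑ s↑ =
    tpM n (λ a → f (r a)) s (λ a b a<b → f↑ (r↑ a b a<b)) s↑

  FullyInterlacing-cong : ∀ {p q} .{{_ : NonZero p}} .{{_ : NonZero q}}
                          {A B : Fin p → Fin q → PowerSeries Carrier} → (∀ i j → A i j ≡ B i j) →
                          FullyInterlacing p q A → FullyInterlacing p q B
  FullyInterlacing-cong {p} {q} {A} {B} A≗B =
    TotallyPositive-cong {Lace p q A} {Lace p q B} λ u v →
      cong (λ f → coeffℤ f (quotℤ q v ℤ.- quotℤ p u)) (A≗B (remℤ p u) (remℤ q v))

  toℕ-remℤ : ∀ d .{{_ : NonZero d}} u → toℕ (remℤ d u) ≡ u %ℕ d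
  toℕ-remℤ d u = FinP.toℕ-fromℕ< (n%ℕd<d u d)

  spreadRows : ∀ k p .{{_ : NonZero k}} → (Fin k → Fin p) → ℤ → ℤ
  spreadRows k p σ u = fromQuotRem p (quotℤ k u , toℕ (σ (remℤ k u)))

  spreadRows-strictlyIncreasing : ∀ k p .{{_ : NonZero k}} {σ : Fin k → Fin p} →
                                  StrictlyIncreasingFin σ → spreadRows k p σ Preserves ℤ._<_ ⟶ ℤ._<_
  spreadRows-strictlyIncreasing k p {σ} σ↑ {u} {w} u<w =
    fromQuotRem-mono-< p (FinP.toℕ<n (σ (remℤ k u))) (spread-lex quot-rem-lex)
    where
    quot-rem-lex : quotRem k u <ₗₑₓ quotRem k w
    quot-rem-lex = fromQuotRem-cancel-< k (n%ℕd<d w k)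
      (subst₂ ℤ._<_ (fromQuotRem-quotRem k u) (fromQuotRem-quotRem k w) u<w)

    spread-lex : quotRem k u <ₗₑₓ quotRem k w →
                 (quotℤ k u , toℕ (σ (remℤ k u))) <ₗₑₓ (quotℤ k w , toℕ (σ (remℤ k w)))
    spread-lex (inj₁ q<q′)          = inj₁ q<q′
    spread-lex (inj₂ (q≡q′ , i<i′)) =
      inj₂ (q≡q′ , σ↑ _ _ (subst₂ ℕ._<_ (sym (toℕ-remℤ k u)) (sym (toℕ-remℤ k w)) i<i′))

  Lace-rows : ∀ k p q .{{_ : NonZero k}} .{{_ : NonZero p}} .{{_ : NonZero q}}
              (A : Fin p → Fin q → PowerSeries Carrier) (σ : Fin k → Fin p) u v →
              Lace k q (λ a → A (σ a)) u v ≡ Lace p q A (spreadRows k p σ u) v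
  Lace-rows k p q A σ u v =
    cong₂ (λ i u′ → coeffℤ (A i (remℤ q v)) (quotℤ q v ℤ.- u′)) (sym rem≡) (sym quot≡)
    where
    quotRem≡ : quotRem p (spreadRows k p σ u) ≡ (quotℤ k u , toℕ (σ (remℤ k u)))
    quotRem≡ = quotRem-fromQuotRem p _ (FinP.toℕ<n (σ (remℤ k u)))
    quot≡ : quotℤ p (spreadRows k p σ u) ≡ quotℤ k u
    quot≡ = cong proj₁ quotRem≡
    rem≡ : remℤ p (spreadRows k p σ u) ≡ σ (remℤ k u)
    rem≡ = FinP.toℕ-injective (trans (toℕ-remℤ p (spreadRows k p σ u)) (cong proj₂ quotRem≡))

  FullyInterlacing-rows : ∀ {k p q} .{{_ : NonZero k}} .{{_ : NonZero p}} .{{_ : NonZero q}}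
                          {A : Fin p → Fin q → PowerSeries Carrier} {σ : Fin k → Fin p} →
                          StrictlyIncreasingFin σ →
                          FullyInterlacing p q A → FullyInterlacing k q (λ a → A (σ a))
  FullyInterlacing-rows {k} {p} {q} {A} {σ} σ↑ fiA =
    TotallyPositive-cong (λ u v → sym (Lace-rows k p q A σ u v))
      (TotallyPositive-rows {Lace p q A} (spreadRows-strictlyIncreasing k p σ↑) fiA)

proposition3p2 : ∀ {c ℓ ℓ'} (R : CommutativeRing c ℓ)
    (_≤_ : Rel (CommutativeRing.Carrier R) ℓ') →
    let open OverRing R _≤_ in
    (p : ℕ) → .{{_ : NonZero p}} → (A : Fin p → PowerSeries (CommutativeRing.Carrier R)) →
    FullyInterlacingSeq p A →
    ((k : ℕ) → .{{_ : NonZero k}} → (σ : Fin k → Fin p) → StrictlyIncreasingFin σ →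
      FullyInterlacingSeq k (λ a → A (σ a)))
    × (∀ (i j : Fin p) → i Fin.< j → A i ≺ A j)
proposition3p2 R _≤_ p A fiA = subsequence , pairwise
  where
  open OverRing R _≤_
  subsequence : (k : ℕ) → .{{_ : NonZero k}} → (σ : Fin k → Fin p) → StrictlyIncreasingFin σ →
                FullyInterlacingSeq k (λ a → A (σ a))
  subsequence k σ σ↑ = FullyInterlacing-rows R _≤_ {A = asColumn A} σ↑ fiA

  pair-strictlyIncreasing : ∀ {i j} → i Fin.< j → StrictlyIncreasingFin (i ∷ j ∷ [])
  pair-strictlyIncreasing i<j zero       (suc zero) _ = i<j
  pair-strictlyIncreasing i<j (suc zero) (suc zero) (ℕ.s≤s ())

  pair≗subsequence : ∀ i j a → pair (A i) (A j) a ≡ A ((i ∷ j ∷ []) a)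
  pair≗subsequence i j zero       = refl
  pair≗subsequence i j (suc zero) = refl

  pairwise : ∀ i j → i Fin.< j → A i ≺ A j
  pairwise i j i<j = FullyInterlacing-cong R _≤_ (λ a _ → sym (pair≗subsequence i j a))
    (subsequence 2 (i ∷ j ∷ []) (pair-strictlyIncreasing i<j))
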